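{- For both the intuitionistic (BI) and the classical (BBI) variants: for every formula $\varphi$ of (B)BI pointer logic whose free variables are among $v_1,\dots,v_n$, every store $s=\{(v_1,a_1),\dots,(v_n,a_n)\}$ and every heap $h$, we have $s,h\vDash\varphi$ if and only if $((a_1,\dots,a_n),h),[\![-]\!]\vDash^{\Gamma}\varphi$, where $\Gamma=\{v_1,\dots,v_n\}$.
   Context: Heaps: partial functions $h:\mathbb{N}\rightharpoonup\mathbb{Z}$, $H$ the set of heaps; $dom(h)$ its domain; $h\#h'$ iff $dom(h)\cap dom(h')=\emptyset$; $h\cdot h'$ the union of functions with disjoint domains; $h\sqsubseteq h'$ iff the graph of $h$ is contained in that of $h'$; $[]$ the empty heap. Stores: finite partial maps from variables to $\mathbb{Z}$; $[s\mid v\mapsto a]$ updates $s$. Expressions $E$ built from variables, integer constants, $+$, $-$, with value $[\![E]\!]s\in\mathbb{Z}$. Pointer logic formulas: $\varphi::=E=E'\mid E\mapsto F\mid\top\mid\bot\mid\mathrm{Emp}\mid\varphi\wedge\varphi\mid\varphi\vee\varphi\mid\varphi\to\varphi\mid\varphi*\varphi\mid\varphi\mathbin{ -\!\!*}\varphi\mid\exists v.\varphi\mid\forall v.\varphi$. Store–heap satisfaction (BI variant): $s,h\vDash E=E'$ iff $[\![E]\!]s=[\![E']\!]s$; $s,h\vDash E\mapsto F$ iff $[\![E]\!]s\in dom(h)$ and $h([\![E]\!]s)=[\![F]\!]s$; $\top$ always, $\bot$ never, $\wedge,\vee$ pointwise; $s,h\vDash\varphi\to\psi$ iff for all $h'\sqsupseteq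 h$, $s,h'\vDash\varphi$ implies $s,h'\vDash\psi$; $s,h\vDash\mathrm{Emp}$ iff $h\sqsupseteq[]$; $s,h\vDash\varphi*\psi$ iff there are $h',h''$ with $h'\#h''$, $h=h'\cdot h''$, $s,h'\vDash\varphi$, $s,h''\vDash\psi$; $s,h\vDash\varphi\mathbin{ -\!\!*}\psi$ iff for all $h'$ with $h\#h'$, $s,h'\vDash\varphi$ implies $s,h\cdot h'\vDash\psi$; $s,h\vDash\exists v.\varphi$ iff for some $a\in\mathbb{Z}$, $[s\mid v\mapsto a],h\vDash\varphi$; $s,h\vDash\forall v.\varphi$ iff for all $a\in\mathbb{Z}$, $[s\mid v\mapsto a],h\vDash\varphi$. BBI variant: replace $\sqsupseteq$ by $=$ in the clauses for $\to$ and $\mathrm{Emp}$, and use $s,h\vDash E\mapsto F$ iff $\{[\![E]\!]s\}=dom(h)$ and $h([\![E]\!]s)=[\![F]\!]s$. Indexed frame: $\mathrm{Store}:\mathbf{Set}\to$ frames, $\mathrm{Store}(X)=X\times H$ with composition $(x_2,h_2)\in(x_0,h_0)\uplus_X(x_1,h_1)$ iff $x_0=x_1=x_2$, $h_0\#h_1$ and $h_2=h_0\cdot h_1$; in the BI variant the order is $(x_0,h_0)\sqsubseteq_X(x_1,h_1)$ iff $x_0=x_1$, $h_0\sqsubseteq h_1$ and the unit set is $E_X=X\times H$; in the BBI variant the order is equality and $E_X=X\times\{[]\}$. On maps, $\mathrm{Store}(f)(x,h)=(f(x),h)$. Interpretation: the single type is interpreted as $\mathbb{Z}$, context $\Gamma=\{v_1,\dots,v_n\}$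 as $\mathbb{Z}^n$, a term $t$ as the function $[\![t]\!]:\mathbb{Z}^n\to\mathbb{Z}$ (variables as projections, constants constant, $+,-$ pointwise). The points-to predicate: BI: $[\![\mapsto]\!]=\{((a,a'),h)\mid a\in dom(h),h(a)=a'\}$; BBI: $[\![\mapsto]\!]=\{((a,a'),h)\mid\{a\}=dom(h),h(a)=a'\}$. Writing $R=\mathrm{Store}$, $\preccurlyeq$ for its order, $\circ$ for $\uplus$, for $x\in R(\mathbb{Z}^n)$: $x\vDash^\Gamma t\mapsto t'$ iff $R(\langle[\![t]\!],[\![t']\!]\rangle)(x)\in[\![\mapsto]\!]$; $x\vDash^\Gamma t=t'$ iff $R(\langle[\![t]\!],[\![t']\!]\rangle)(x)$ lies in the range of $R(\Delta_{\mathbb{Z}})$ ($\Delta$ the diagonal); $\top$ always, $\bot$ never, $\wedge,\vee$ pointwise; $x\vDash\varphi\to\psi$ iff for all $x'\succcurlyeq x$, $x'\vDash\varphi\Rightarrow x'\vDash\psi$; $x\vDash\mathrm{Emp}$ iff $x\in E_{\mathbb{Z}^n}$; $x\vDash\varphi*\psi$ iff there are $x'\preccurlyeq x$, $y,z$ with $x'\in y\circ z$, $y\vDash\varphi$, $z\vDash\psi$; $x\vDash\varphi\mathbin{ -\!\!*}\psi$ iff for all $x'\succcurlyeq x$, $y,z$ with $z\in x'\circ y$, $y\vDash\varphi\Rightarrow z\vDash\psi$; $x\vDash^\Gamma\exists v_{n+1}\varphi$ iff there is $x'\in R(\mathbb{Z}^{n+1})$ with $R(\pi)(x')=x$ and $x'\vDash^{\Gamma\cup\{v_{n+1}\}}\varphi$,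 where $\pi:\mathbb{Z}^{n+1}\to\mathbb{Z}^n$ is the projection; $x\vDash^\Gamma\forall v_{n+1}\varphi$ iff for all $x'\in R(\mathbb{Z}^{n+1})$ with $R(\pi)(x')\succcurlyeq x$, $x'\vDash^{\Gamma\cup\{v_{n+1}\}}\varphi$. Bound variables are renamed to be fresh. -}

module Defs where

open import Data.Nat using (ℕ; suc)
open import Data.Integer using (ℤ; +_) renaming (_+_ to _+ℤ_; _-_ to _-ℤ_)
open import Data.Maybe using (Maybe; just; nothing)
open import Data.Fin using (Fin)
open import Data.Vec using (Vec; lookup; init; _∷ʳ_)
open import Data.Product using (Σ; _×_; _,_; proj₁; proj₂)
open import Data.Sum using (_⊎_)
open import Data.Unit using (⊤)
open import Data.Empty using (⊥)
open import Relation.Nullary using (¬_)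
open import Relation.Binary.PropositionalEquality using (_≡_)

Heap : Set
Heap = ℕ → Maybe ℤ

emptyHeap : Heap
emptyHeap _ = nothing

_∈dom_ : ℕ → Heap → Set
k ∈dom h = Σ ℤ λ a → h k ≡ just a

_∈domℤ_ : ℤ → Heap → Set
a ∈domℤ h = Σ ℕ λ k → (+ k ≡ a) × (k ∈dom h)

_≈H_ : Heap → Heap → Set
h ≈H h' = ∀ k → h k ≡ h' k

_#_ : Heap → Heap → Set
h # h' = ∀ k → ¬ (k ∈dom h × k ∈dom h')

-- h · h' (union of functions; meaningful for disjoint domains)
_·_ : Heap → Heap → Heap
(h · h') k with h k
... | just a  = just a
... | nothing = h' k

_⊑_ : Heap → Heap → Set
h ⊑ h' = ∀ k a → h k ≡ just a → h' k ≡ just a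

_at_≡_ : Heap → ℤ → ℤ → Set
h at a ≡ b = Σ ℕ λ k → (+ k ≡ a) × (h k ≡ just b)

singletonDom : ℤ → Heap → Set
singletonDom a h = ∀ k → (+ k ≡ a → k ∈dom h) × (k ∈dom h → + k ≡ a)

data Variant : Set where
  BI BBI : Variant

-- Variables v₁,…,vₙ are represented by Fin n (index i ↦ v_{i+1});
-- a quantifier over a formula with free variables among v₁..vₙ binds the
-- fresh variable v_{n+1} (the last index of Fin (suc n)).

data Term (n : ℕ) : Set where
  var   : Fin n → Term n
  const : ℤ → Term n
  _⊕_   : Term n → Term n → Term n
  _⊖_   : Term n → Term n → Term n

data Formula (n : ℕ) : Set where
  _≐_   : Term n → Term n → Formula n
  _↦_   : Term n → Term n → Formula n
  ⊤f ⊥f Emp : Formula n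
  _∧f_ _∨f_ _⇒f_ _✶_ _−✶_ : Formula n → Formula n → Formula n
  ∃f ∀f : Formula (suc n) → Formula n

-- Store–heap semantics.  A store s = {(v₁,a₁),…,(vₙ,aₙ)} is the vector
-- (a₁,…,aₙ); [s | v_{n+1} ↦ a] is  s ∷ʳ a.

Store : ℕ → Set
Store n = Vec ℤ n

evalS : ∀ {n} → Term n → Store n → ℤ
evalS (var i)   s = lookup s i
evalS (const c) s = c
evalS (t ⊕ u)   s = evalS t s +ℤ evalS u s
evalS (t ⊖ u)   s = evalS t s -ℤ evalS u s

extH : Variant → Heap → Heap → Set
extH BI  h h' = h ⊑ h'
extH BBI h h' = h ≈H h'

ptsS : Variant → ℤ → ℤ → Heap → Set
ptsS BI  a b h = (a ∈domℤ h) × (h at a ≡ b)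
ptsS BBI a b h = singletonDom a h × (h at a ≡ b)

sat : Variant → ∀ {n} → Store n → Heap → Formula n → Set
sat V s h (t ≐ u)   = evalS t s ≡ evalS u s
sat V s h (t ↦ u)   = ptsS V (evalS t s) (evalS u s) h
sat V s h ⊤f        = ⊤
sat V s h ⊥f        = ⊥
sat V s h Emp       = extH V emptyHeap h
sat V s h (φ ∧f ψ)  = sat V s h φ × sat V s h ψ
sat V s h (φ ∨f ψ)  = sat V s h φ ⊎ sat V s h ψ
sat V s h (φ ⇒f ψ)  = ∀ h' → extH V h h' → sat V s h' φ → sat V s h' ψ
sat V s h (φ ✶ ψ)   = Σ Heap λ h₁ → Σ Heap λ h₂ →
                        (h₁ # h₂) × (h ≈H (h₁ · h₂)) × sat V s h₁ φ × sat V s h₂ ψ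
sat V s h (φ −✶ ψ)  = ∀ h' → h # h' → sat V s h' φ → sat V s (h · h') ψ
sat V s h (∃f φ)    = Σ ℤ λ a → sat V (s ∷ʳ a) h φ
sat V s h (∀f φ)    = ∀ a → sat V (s ∷ʳ a) h φ

-- The indexed frame Store : Set → frames,  Store(X) = X × H.

R : Set → Set
R X = X × Heap

_≈R_ : ∀ {X : Set} → R X → R X → Set
(x , h) ≈R (x' , h') = (x ≡ x') × (h ≈H h')

Rmap : ∀ {X Y : Set} → (X → Y) → R X → R Y
Rmap f (x , h) = (f x , h)

_⊢_≼_ : Variant → ∀ {X : Set} → R X → R X → Set
BI  ⊢ (x₀ , h₀) ≼ (x₁ , h₁) = (x₀ ≡ x₁) × (h₀ ⊑ h₁)
BBI ⊢ (x₀ , h₀) ≼ (x₁ , h₁) = (x₀ ≡ x₁) × (h₀ ≈H h₁)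

_∈_∘_ : ∀ {X : Set} → R X → R X → R X → Set
(x₂ , h₂) ∈ (x₀ , h₀) ∘ (x₁ , h₁) =
  (x₀ ≡ x₁) × (x₁ ≡ x₂) × (h₀ # h₁) × (h₂ ≈H (h₀ · h₁))

Unit : Variant → ∀ {X : Set} → R X → Set
Unit BI  _       = ⊤
Unit BBI (_ , h) = h ≈H emptyHeap

⟦_⟧ : ∀ {n} → Term n → Vec ℤ n → ℤ
⟦ var i ⟧   v = lookup v i
⟦ const c ⟧ v = c
⟦ t ⊕ u ⟧   v = ⟦ t ⟧ v +ℤ ⟦ u ⟧ v
⟦ t ⊖ u ⟧   v = ⟦ t ⟧ v -ℤ ⟦ u ⟧ v

⟨_,_⟩ : ∀ {n} → Term n → Term n → Vec ℤ n → ℤ × ℤ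
⟨ t , u ⟩ v = (⟦ t ⟧ v , ⟦ u ⟧ v)

Δ : ℤ → ℤ × ℤ
Δ a = (a , a)

π : ∀ {n} → Vec ℤ (suc n) → Vec ℤ n
π = init

⟦↦⟧ : Variant → R (ℤ × ℤ) → Set
⟦↦⟧ BI  ((a , b) , h) = (a ∈domℤ h) × (h at a ≡ b)
⟦↦⟧ BBI ((a , b) , h) = singletonDom a h × (h at a ≡ b)

force : Variant → ∀ {n} → R (Vec ℤ n) → Formula n → Set
force V x (t ↦ u)  = ⟦↦⟧ V (Rmap ⟨ t , u ⟩ x)
force V x (t ≐ u)  = Σ (R ℤ) λ y → Rmap Δ y ≈R Rmap ⟨ t , u ⟩ x
force V x ⊤f       = ⊤
force V x ⊥f       = ⊥
force V x Emp      = Unit V x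
force V x (φ ∧f ψ) = force V x φ × force V x ψ
force V x (φ ∨f ψ) = force V x φ ⊎ force V x ψ
force V x (φ ⇒f ψ) = ∀ x' → V ⊢ x ≼ x' → force V x' φ → force V x' ψ
force V x (φ ✶ ψ)  = Σ (R _) λ x' → Σ (R _) λ y → Σ (R _) λ z →
                       (V ⊢ x' ≼ x) × (x' ∈ y ∘ z) × force V y φ × force V z ψ
force V x (φ −✶ ψ) = ∀ x' y z → V ⊢ x ≼ x' → z ∈ x' ∘ y →
                       force V y φ → force V z ψ
force V x (∃f φ)   = Σ (R (Vec ℤ _)) λ x' → (Rmap π x' ≈R x) × force V x' φ
force V x (∀f φ)   = ∀ (x' : R (Vec ℤ _)) → V ⊢ x ≼ Rmap π x' → force V x' φ

-- The frame R(X) = X × H never changes the store component along its order or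
-- its composition, so each forcing clause is the corresponding store–heap
-- clause up to bookkeeping, with extending a store by v_{n+1} matching the
-- projection π = init.  The one real difference is that the frame clauses for
-- * and −* quantify over all x' ≼ x (resp. x' ≽ x) where the store semantics
-- uses h itself.  This is bridged by persistence: satisfaction is invariant
-- under heap equality, and in BI it is monotone under heap extension; for
-- φ * ψ the extension g ⊒ h₁ · h₂ is absorbed into the right component as
-- g ∖ h₁ ⊒ h₂.
module Submission where

open import Defs
open import Data.Nat using (ℕ; suc)
open import Data.Vec using (Vec; init; last; _∷ʳ_; initLast)
open import Data.Vec.Properties using (init-∷ʳ)
open import Data.Integer using (ℤ) renaming (_+_ to _+ℤ_; _-_ to _-ℤ_)
open import Data.Product using (_,_; _×_; proj₁; proj₂)
open import Data.Product.Properties using (,-injectiveˡ; ,-injectiveʳ)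
open import Data.Sum using (inj₁; inj₂)
open import Data.Maybe using (just; nothing)
open import Data.Empty using (⊥-elim)
open import Data.Unit using (tt)
open import Function.Bundles using (_⇔_; mk⇔; Equivalence)
open import Function.Properties.Equivalence using () renaming (refl to ⇔-refl)
open import Relation.Binary.PropositionalEquality

open Equivalence

private
  variable
    V : Variant
    n : ℕ
    f g h h' h₁ h₂ : Heap

≈H-refl : h ≈H h
≈H-refl k = refl

≈H-sym : h ≈H g → g ≈H h
≈H-sym e k = sym (e k)

≈H-trans : h ≈H g → g ≈H f → h ≈H f
≈H-trans e e' k = trans (e k) (e' k)

≈H⇒⊑ : h ≈H g → h ⊑ g
≈H⇒⊑ e k a p = trans (sym (e k)) p

⊑-trans : h ⊑ g → g ⊑ f → h ⊑ f
⊑-trans p q k a e = q k a (p k a e)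

emptyHeap-⊑ : emptyHeap ⊑ h
emptyHeap-⊑ k a ()

#-monoˡ : h ⊑ h' → h' # g → h # g
#-monoˡ p d k ((a , e) , q) = d k ((a , p k a e) , q)

⊑-· : ∀ h g → h ⊑ (h · g)
⊑-· h g k a e rewrite e = refl

·-nothing : ∀ (h g : Heap) k → h k ≡ nothing → (h · g) k ≡ g k
·-nothing h g k e rewrite e = refl

·-congˡ : ∀ g → h ≈H h' → (h · g) ≈H (h' · g)
·-congˡ {h} {h'} g e k with h k | h' k | e k
... | x | .x | refl = refl

·-monoˡ : ∀ g → h ⊑ h' → h' # g → (h · g) ⊑ (h' · g)
·-monoˡ {h} {h'} g p d k a e with h k in eq
... | just b = trans (⊑-· h' g k b (p k b eq)) e
... | nothing with h' k in eq'
...   | just c = ⊥-elim (d k ((c , eq') , (a , e)))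
...   | nothing = e

_∖_ : Heap → Heap → Heap
(g ∖ h) k with h k
... | just _  = nothing
... | nothing = g k

∖-just : ∀ g h k {a} → h k ≡ just a → (g ∖ h) k ≡ nothing
∖-just g h k e rewrite e = refl

∖-nothing : ∀ g h k → h k ≡ nothing → (g ∖ h) k ≡ g k
∖-nothing g h k e rewrite e = refl

#-∖ : h # (g ∖ h)
#-∖ {h} {g} k ((a , p) , (b , q)) with trans (sym (∖-just g h k p)) q
... | ()

⊑⇒≈H-·-∖ : h ⊑ g → g ≈H (h · (g ∖ h))
⊑⇒≈H-·-∖ {h} {g} p k with h k in eq
... | just a  = p k a eq
... | nothing = sym (∖-nothing g h k eq)

·-⊑⇒⊑-∖ : h₁ # h₂ → (h₁ · h₂) ⊑ g → h₂ ⊑ (g ∖ h₁)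
·-⊑⇒⊑-∖ {h₁} {h₂} {g} d p k a q with h₁ k in eq
... | just b  = ⊥-elim (d k ((b , eq) , (a , q)))
... | nothing = p k a (trans (·-nothing h₁ h₂ k eq) q)

≈H⇒extH : ∀ V → h ≈H g → extH V h g
≈H⇒extH BI  e = ≈H⇒⊑ e
≈H⇒extH BBI e = e

extH-refl : ∀ V → extH V h h
extH-refl V = ≈H⇒extH V ≈H-refl

extH-respˡ-≈H : ∀ V → h ≈H g → extH V g f → extH V h f
extH-respˡ-≈H BI  e p = ⊑-trans (≈H⇒⊑ e) p
extH-respˡ-≈H BBI e p = ≈H-trans e p

≼⇒≡×extH : ∀ V {X : Set} {x x' : X} → V ⊢ (x , h) ≼ (x' , h') → (x ≡ x') × extH V h h'
≼⇒≡×extH BI  p = p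
≼⇒≡×extH BBI p = p

≡×extH⇒≼ : ∀ V {X : Set} {x x' : X} → x ≡ x' → extH V h h' → V ⊢ (x , h) ≼ (x' , h')
≡×extH⇒≼ BI  p q = p , q
≡×extH⇒≼ BBI p q = p , q

≼-refl : ∀ V {X : Set} {x : X} → V ⊢ (x , h) ≼ (x , h)
≼-refl V = ≡×extH⇒≼ V refl (extH-refl V)

evalS≡⟦⟧ : (t : Term n) (s : Store n) → evalS t s ≡ ⟦ t ⟧ s
evalS≡⟦⟧ (var i)   s = refl
evalS≡⟦⟧ (const c) s = refl
evalS≡⟦⟧ (t ⊕ u)   s = cong₂ _+ℤ_ (evalS≡⟦⟧ t s) (evalS≡⟦⟧ u s)
evalS≡⟦⟧ (t ⊖ u)   s = cong₂ _-ℤ_ (evalS≡⟦⟧ t s) (evalS≡⟦⟧ u s)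

init-∷ʳ-last : (xs : Vec ℤ (suc n)) → init xs ∷ʳ last xs ≡ xs
init-∷ʳ-last xs = sym (proj₂ (proj₂ (initLast xs)))

sat-resp-≈H : ∀ V (φ : Formula n) (s : Store n) → h ≈H g → sat V s h φ → sat V s g φ
sat-resp-≈H V (t ≐ u) s e x = x
sat-resp-≈H BI (t ↦ u) s e ((k , q , (a , r)) , (k' , q' , r')) =
  (k , q , (a , trans (sym (e k)) r)) , (k' , q' , trans (sym (e k')) r')
sat-resp-≈H BBI (t ↦ u) s e (dom , (k' , q' , r')) =
  (λ k → (λ q → let a , r = proj₁ (dom k) q in a , trans (sym (e k)) r) ,
         (λ { (a , r) → proj₂ (dom k) (a , trans (e k) r) })) ,
  (k' , q' , trans (sym (e k')) r')
sat-resp-≈H V ⊤f s e x = x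
sat-resp-≈H BI Emp s e x = emptyHeap-⊑
sat-resp-≈H BBI Emp s e x = ≈H-trans x e
sat-resp-≈H V (φ ∧f ψ) s e (a , b) = sat-resp-≈H V φ s e a , sat-resp-≈H V ψ s e b
sat-resp-≈H V (φ ∨f ψ) s e (inj₁ a) = inj₁ (sat-resp-≈H V φ s e a)
sat-resp-≈H V (φ ∨f ψ) s e (inj₂ b) = inj₂ (sat-resp-≈H V ψ s e b)
sat-resp-≈H V (φ ⇒f ψ) s e f h' p = f h' (extH-respˡ-≈H V e p)
sat-resp-≈H V (φ ✶ ψ) s e (h₁ , h₂ , d , e' , a , b) = h₁ , h₂ , d , ≈H-trans (≈H-sym e) e' , a , b
sat-resp-≈H V (φ −✶ ψ) s e f h' d x =
  sat-resp-≈H V ψ s (·-congˡ h' e) (f h' (#-monoˡ (≈H⇒⊑ e) d) x)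
sat-resp-≈H V (∃f φ) s e (a , x) = a , sat-resp-≈H V φ (s ∷ʳ a) e x
sat-resp-≈H V (∀f φ) s e f a = sat-resp-≈H V φ (s ∷ʳ a) e (f a)

sat-mono-⊑ : (φ : Formula n) (s : Store n) → h ⊑ g → sat BI s h φ → sat BI s g φ
sat-mono-⊑ (t ≐ u) s p x = x
sat-mono-⊑ (t ↦ u) s p ((k , q , (a , r)) , (k' , q' , r')) = (k , q , (a , p k a r)) , (k' , q' , p k' _ r')
sat-mono-⊑ ⊤f s p x = x
sat-mono-⊑ Emp s p x = emptyHeap-⊑
sat-mono-⊑ (φ ∧f ψ) s p (a , b) = sat-mono-⊑ φ s p a , sat-mono-⊑ ψ s p b
sat-mono-⊑ (φ ∨f ψ) s p (inj₁ a) = inj₁ (sat-mono-⊑ φ s p a)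
sat-mono-⊑ (φ ∨f ψ) s p (inj₂ b) = inj₂ (sat-mono-⊑ ψ s p b)
sat-mono-⊑ (φ ⇒f ψ) s p f h' q = f h' (⊑-trans p q)
sat-mono-⊑ {g = g} (φ ✶ ψ) s p (h₁ , h₂ , d , e , a , b) =
  h₁ , g ∖ h₁ , #-∖ , ⊑⇒≈H-·-∖ (⊑-trans (⊑-· h₁ h₂) h₁·h₂⊑g) , a ,
  sat-mono-⊑ ψ s (·-⊑⇒⊑-∖ d h₁·h₂⊑g) b
  where
  h₁·h₂⊑g : (h₁ · h₂) ⊑ g
  h₁·h₂⊑g = ⊑-trans (≈H⇒⊑ (≈H-sym e)) p
sat-mono-⊑ (φ −✶ ψ) s p f h' d x = sat-mono-⊑ ψ s (·-monoˡ h' p d) (f h' (#-monoˡ p d) x)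
sat-mono-⊑ (∃f φ) s p (a , x) = a , sat-mono-⊑ φ (s ∷ʳ a) p x
sat-mono-⊑ (∀f φ) s p f a = sat-mono-⊑ φ (s ∷ʳ a) p (f a)

sat-extH : ∀ V (φ : Formula n) (s : Store n) → extH V h g → sat V s h φ → sat V s g φ
sat-extH BI  = sat-mono-⊑
sat-extH BBI = sat-resp-≈H BBI

Agree : Variant → Formula n → Set
Agree V φ = ∀ s h → sat V s h φ ⇔ force V (s , h) φ

agree-≐ : ∀ V (t u : Term n) → Agree V (t ≐ u)
agree-≐ V t u s h rewrite evalS≡⟦⟧ t s | evalS≡⟦⟧ u s = mk⇔
  (λ e → (⟦ t ⟧ s , h) , (cong (⟦ t ⟧ s ,_) e , ≈H-refl))
  (λ { (_ , p , _) → trans (sym (,-injectiveˡ p)) (,-injectiveʳ p) })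

ptsS⇔⟦↦⟧ : ∀ V a b h → ptsS V a b h ⇔ ⟦↦⟧ V ((a , b) , h)
ptsS⇔⟦↦⟧ BI  a b h = ⇔-refl
ptsS⇔⟦↦⟧ BBI a b h = ⇔-refl

agree-↦ : ∀ V (t u : Term n) → Agree V (t ↦ u)
agree-↦ V t u s h rewrite evalS≡⟦⟧ t s | evalS≡⟦⟧ u s = ptsS⇔⟦↦⟧ V _ _ h

agree-Emp : ∀ V → Agree {n} V Emp
agree-Emp BI  s h = mk⇔ (λ _ → tt) (λ _ → emptyHeap-⊑)
agree-Emp BBI s h = mk⇔ ≈H-sym ≈H-sym

module _ (φ ψ : Formula n) (φ↔ : Agree V φ) (ψ↔ : Agree V ψ) where

  agree-∧ : Agree V (φ ∧f ψ)
  agree-∧ s h = mk⇔ (λ (a , b) → to (φ↔ s h) a , to (ψ↔ s h) b)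
                    (λ (a , b) → from (φ↔ s h) a , from (ψ↔ s h) b)

  agree-∨ : Agree V (φ ∨f ψ)
  agree-∨ s h = mk⇔ (λ { (inj₁ a) → inj₁ (to (φ↔ s h) a) ; (inj₂ b) → inj₂ (to (ψ↔ s h) b) })
                    (λ { (inj₁ a) → inj₁ (from (φ↔ s h) a) ; (inj₂ b) → inj₂ (from (ψ↔ s h) b) })

  agree-⇒ : Agree V (φ ⇒f ψ)
  agree-⇒ s h = mk⇔ sat⇒force force⇒sat
    where
    sat⇒force : sat V s h (φ ⇒f ψ) → force V (s , h) (φ ⇒f ψ)
    sat⇒force f (s' , h') le x with ≼⇒≡×extH V le
    ... | refl , ext = to (ψ↔ s h') (f h' ext (from (φ↔ s h') x))

    force⇒sat : force V (s , h) (φ ⇒f ψ) → sat V s h (φ ⇒f ψ)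
    force⇒sat f h' ext x = from (ψ↔ s h') (f (s , h') (≡×extH⇒≼ V refl ext) (to (φ↔ s h') x))

  agree-✶ : Agree V (φ ✶ ψ)
  agree-✶ s h = mk⇔ sat⇒force force⇒sat
    where
    sat⇒force : sat V s h (φ ✶ ψ) → force V (s , h) (φ ✶ ψ)
    sat⇒force (h₁ , h₂ , d , e , a , b) =
      (s , h) , (s , h₁) , (s , h₂) , ≼-refl V , (refl , refl , d , e) ,
      to (φ↔ s h₁) a , to (ψ↔ s h₂) b

    force⇒sat : force V (s , h) (φ ✶ ψ) → sat V s h (φ ✶ ψ)
    force⇒sat ((_ , h') , (_ , h₁) , (_ , h₂) , le , (refl , refl , d , e) , a , b)
      with ≼⇒≡×extH V le
    ... | refl , ext =
      sat-extH V (φ ✶ ψ) s ext (h₁ , h₂ , d , e , from (φ↔ s h₁) a , from (ψ↔ s h₂) b)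

  agree-−✶ : Agree V (φ −✶ ψ)
  agree-−✶ s h = mk⇔ sat⇒force force⇒sat
    where
    sat⇒force : sat V s h (φ −✶ ψ) → force V (s , h) (φ −✶ ψ)
    sat⇒force f (_ , h') (_ , h₁) (_ , h₂) le (refl , refl , d , e) a with ≼⇒≡×extH V le
    ... | refl , ext = to (ψ↔ s h₂)
      (sat-resp-≈H V ψ s (≈H-sym e) (sat-extH V (φ −✶ ψ) s ext f h₁ d (from (φ↔ s h₁) a)))

    force⇒sat : force V (s , h) (φ −✶ ψ) → sat V s h (φ −✶ ψ)
    force⇒sat f h' d a = from (ψ↔ s (h · h'))
      (f (s , h) (s , h') (s , h · h') (≼-refl V) (refl , refl , d , ≈H-refl) (to (φ↔ s h') a))

module _ (φ : Formula (suc n)) (φ↔ : Agree V φ) where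

  agree-∃ : Agree V (∃f φ)
  agree-∃ s h = mk⇔ sat⇒force force⇒sat
    where
    sat⇒force : sat V s h (∃f φ) → force V (s , h) (∃f φ)
    sat⇒force (a , x) = (s ∷ʳ a , h) , (init-∷ʳ a s , ≈H-refl) , to (φ↔ (s ∷ʳ a) h) x

    force⇒sat : force V (s , h) (∃f φ) → sat V s h (∃f φ)
    force⇒sat ((s' , h') , (refl , e) , x) = last s' ,
      subst (λ s'' → sat V s'' h φ) (sym (init-∷ʳ-last s'))
            (sat-resp-≈H V φ s' e (from (φ↔ s' h') x))

  agree-∀ : Agree V (∀f φ)
  agree-∀ s h = mk⇔ sat⇒force force⇒sat
    where
    sat⇒force : sat V s h (∀f φ) → force V (s , h) (∀f φ)
    sat⇒force f (s' , h') le with ≼⇒≡×extH V le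
    ... | refl , ext = to (φ↔ s' h')
      (sat-extH V φ s' ext (subst (λ s'' → sat V s'' h φ) (init-∷ʳ-last s') (f (last s'))))

    force⇒sat : force V (s , h) (∀f φ) → sat V s h (∀f φ)
    force⇒sat f a = from (φ↔ (s ∷ʳ a) h)
      (f (s ∷ʳ a , h) (≡×extH⇒≼ V (sym (init-∷ʳ a s)) (extH-refl V)))

agree : ∀ V (φ : Formula n) → Agree V φ
agree V (t ≐ u)  = agree-≐ V t u
agree V (t ↦ u)  = agree-↦ V t u
agree V ⊤f       = λ _ _ → ⇔-refl
agree V ⊥f       = λ _ _ → ⇔-refl
agree V Emp      = agree-Emp V
agree V (φ ∧f ψ) = agree-∧ φ ψ (agree V φ) (agree V ψ)
agree V (φ ∨f ψ) = agree-∨ φ ψ (agree V φ) (agree V ψ)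
agree V (φ ⇒f ψ) = agree-⇒ φ ψ (agree V φ) (agree V ψ)
agree V (φ ✶ ψ)  = agree-✶ φ ψ (agree V φ) (agree V ψ)
agree V (φ −✶ ψ) = agree-−✶ φ ψ (agree V φ) (agree V ψ)
agree V (∃f φ)   = agree-∃ φ (agree V φ)
agree V (∀f φ)   = agree-∀ φ (agree V φ)

theorem5p5 : (V : Variant) (n : ℕ) (φ : Formula n) (s : Vec ℤ n) (h : Heap) →
    sat V s h φ ⇔ force V (s , h) φ
theorem5p5 V n φ s h = agree V φ s h
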